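{- Let $H$ be a digraph (possibly with loops), $D$ an $H$-colored digraph and $\mathscr{F}$ an $H$-class partition of $A(D)$. If for every $F\in\mathscr{F}$ the digraph $D\langle F\rangle$ is strongly connected, then for every $k\geq 2$ and $l\geq k+1$, $D$ has a $(k,l,H)$-kernel by walks.
   Context: An $H$-colored digraph is a finite digraph $D$ without loops with a coloring $\rho:A(D)\to V(H)$. For $F\subseteq A(D)$, $D\langle F\rangle$ is the digraph with arc set $F$ and vertex set the vertices incident with an arc of $F$. An $H$-class partition of $A(D)$ is a partition $\mathscr{F}$ of $A(D)$ such that for all arcs $(u,v),(v,w)$ of $D$, $(\rho(u,v),\rho(v,w))\in A(H)$ iff some $F\in\mathscr{F}$ contains both arcs. For a walk $W=(x_0,\ldots,x_n)$ in $D$, there is an obstruction on $x_i$ if $(\rho(x_{i-1},x_i),\rho(x_i,x_{i+1}))\notin A(H)$; for open $W$, the $H$-length $l_H(W)$ is $1$ plus the number of $i\in\{1,\dots,n-1\}$ with an obstruction on $x_i$. A set $S\subseteq V(D)$ is a $(k,l,H)$-kernel by walks ($k\ge2$, $l\ge1$) if every walk between two different vertices of $S$ has $H$-length at least $k$ and every $x\in V(D)\setminus S$ has a walk to a vertex of $S$ of $H$-length at most $l$. -}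

module Defs where

open import Data.Nat using (ℕ; zero; suc; _+_; _≤_)
open import Data.Bool using (Bool; true; false; T; if_then_else_)
open import Data.Fin using (Fin)
open import Data.Fin.Subset using (Subset; _∈_; _∉_)
open import Data.Product using (Σ; ∃; _×_; _,_)
open import Data.Sum using (_⊎_)
open import Relation.Binary.PropositionalEquality using (_≡_; _≢_)
open import Relation.Nullary using (¬_)
open import Function.Bundles using (_⇔_)

record Digraph : Set where
  field
    hsize : ℕ
    harc  : Fin hsize → Fin hsize → Bool

-- A finite H-colored digraph D without loops, on vertex set Fin n.
-- The coloring ρ is given as a function on all ordered pairs; only its
-- values on arcs of D are ever used.
record HColoredDigraph (H : Digraph) : Set where
  open Digraph H
  field
    n        : ℕ
    arc      : Fin n → Fin n → Bool
    loopless : ∀ v → arc v v ≡ false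
    ρ        : Fin n → Fin n → Fin hsize

data Walk {n : ℕ} (R : Fin n → Fin n → Set) : Fin n → Fin n → Set where
  edge : ∀ {u v} → R u v → Walk R u v
  step : ∀ {u v w} → R u v → Walk R v w → Walk R u w

module _ {H : Digraph} (D : HColoredDigraph H) where
  open Digraph H
  open HColoredDigraph D

  Arc : Fin n → Fin n → Set
  Arc u v = T (arc u v)

  DWalk : Fin n → Fin n → Set
  DWalk = Walk Arc

  second : ∀ {u v} → DWalk u v → Fin n
  second (edge {v = v} _) = v
  second (step {v = v} _ _) = v

  obstruction : Fin n → Fin n → Fin n → ℕ
  obstruction u v x = if harc (ρ u v) (ρ v x) then 0 else 1

  hlength : ∀ {u v} → DWalk u v → ℕ
  hlength (edge _) = 1
  hlength (step {u = u} {v = v} _ W) = obstruction u v (second W) + hlength W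

  -- An H-class partition of A(D), given as an assignment of a class index
  -- (in Fin m) to each arc; the classes are the nonempty fibres.
  IsHClassPartition : (m : ℕ) → (Fin n → Fin n → Fin m) → Set
  IsHClassPartition m cls =
    ∀ u v w → Arc u v → Arc v w →
      (T (harc (ρ u v) (ρ v w)) ⇔ (cls u v ≡ cls v w))

  module _ {m : ℕ} (cls : Fin n → Fin n → Fin m) where
    ClassArc : Fin m → Fin n → Fin n → Set
    ClassArc i u v = Arc u v × cls u v ≡ i

    Incident : Fin m → Fin n → Set
    Incident i x = ∃ λ y → ClassArc i x y ⊎ ClassArc i y x

    StronglyConnected : Fin m → Set
    StronglyConnected i =
      ∀ x y → Incident i x → Incident i y → x ≢ y → Walk (ClassArc i) x y

  IsKLHKernel : ℕ → ℕ → Subset n → Set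
  IsKLHKernel k l S =
    (∀ x y → x ∈ S → y ∈ S → x ≢ y → (W : DWalk x y) → k ≤ hlength W)
    × (∀ x → x ∉ S → ∃ λ y → y ∈ S × Σ (DWalk x y) λ W → hlength W ≤ l)

-- Call two vertices of D linked when some class of the partition touches both. Inside a class
-- any two vertices are joined by a walk of H-length 1 (strong connectivity, and no obstruction
-- occurs between arcs of one class), so a path of h links yields a walk of H-length at most h.
-- Conversely, a walk of H-length h crosses at most h - 1 obstructions, and an arc pair without
-- obstruction lies in one class, so the walk passes through at most h classes; this gives a
-- path of h links from any vertex of its first class. Therefore a maximal set of
-- vertices pairwise not joined by k - 1 links is a (k, k - 1, H)-kernel by walks; only k ≥ 1
-- and l ≥ k - 1 are needed.
module Submission where

open import Defs
open import Data.Nat using (ℕ; zero; suc; _+_; _≤_; _≤?_; s≤s)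
open import Data.Nat.Properties
  using (≤-refl; ≤-trans; ≤-reflexive; +-assoc; ≤-pred; ≰⇒>; m≤m+n; m≤n+m; +-mono-≤; n≤1+n; <⇒≤)
open import Data.Bool using (true; false; T)
open import Data.Fin using (Fin; _≟_)
open import Data.Fin.Subset using (Subset; _∈_; _∉_; _∪_; ⁅_⁆; ⊥; _⊆_)
open import Data.Fin.Subset.Properties using (_∈?_; ∉⊥; x∈p∪q⁺; x∈p∪q⁻; x∈⁅x⁆; x∈⁅y⁆⇒x≡y)
open import Data.Fin.Properties using (any?)
open import Data.List using (List; []; _∷_; allFin)
open import Data.List.Relation.Unary.Any using (here; there)
import Data.List.Membership.Propositional as List
open import Data.List.Membership.Propositional.Properties using (∈-allFin)
open import Data.Product using (Σ; ∃; _×_; _,_; proj₁)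
open import Data.Sum using (_⊎_; inj₁; inj₂)
open import Data.Empty using (⊥-elim)
import Data.Empty as Empty
open import Function.Bundles using (Equivalence)
open import Relation.Binary using (Decidable; Symmetric)
open import Relation.Nullary using (¬_; Dec; yes; no)
open import Relation.Nullary.Decidable using (T?; _×-dec_; _⊎-dec_)
open import Relation.Binary.PropositionalEquality
  using (_≡_; refl; sym; trans; _≢_; cong₂; subst)

module MaximalIndependentSet {n : ℕ} {R : Fin n → Fin n → Set}
  (R? : Decidable R) (R-sym : Symmetric R) where

  Independent : Subset n → Set
  Independent S = ∀ {x y} → x ∈ S → y ∈ S → x ≢ y → ¬ R x y

  Absorbed : Subset n → Fin n → Set
  Absorbed S x = x ∈ S ⊎ ∃ λ y → y ∈ S × R x y

  greedy : Subset n → List (Fin n) → Subset n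
  greedy S [] = S
  greedy S (v ∷ vs) with any? (λ u → u ∈? S ×-dec R? v u)
  ... | yes _ = greedy S vs
  ... | no _ = greedy (S ∪ ⁅ v ⁆) vs

  ∈-∪⁅⁆⁻ : ∀ {S : Subset n} {v x} → x ∈ S ∪ ⁅ v ⁆ → x ∈ S ⊎ x ≡ v
  ∈-∪⁅⁆⁻ {S} {v} x∈ with x∈p∪q⁻ S ⁅ v ⁆ x∈
  ... | inj₁ x∈S = inj₁ x∈S
  ... | inj₂ x∈v = inj₂ (x∈⁅y⁆⇒x≡y v x∈v)

  independent-∪⁅⁆ : ∀ {S : Subset n} {v} → Independent S → ¬ (∃ λ u → u ∈ S × R v u) →
    Independent (S ∪ ⁅ v ⁆)
  independent-∪⁅⁆ ind fresh x∈ y∈ x≢y Rxy with ∈-∪⁅⁆⁻ x∈ | ∈-∪⁅⁆⁻ y∈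
  ... | inj₁ x∈S | inj₁ y∈S = ind x∈S y∈S x≢y Rxy
  ... | inj₁ x∈S | inj₂ refl = fresh (_ , x∈S , R-sym Rxy)
  ... | inj₂ refl | inj₁ y∈S = fresh (_ , y∈S , Rxy)
  ... | inj₂ refl | inj₂ refl = x≢y refl

  greedy-⊇ : ∀ (S : Subset n) vs → S ⊆ greedy S vs
  greedy-⊇ S [] x∈ = x∈
  greedy-⊇ S (v ∷ vs) x∈ with any? (λ u → u ∈? S ×-dec R? v u)
  ... | yes _ = greedy-⊇ S vs x∈
  ... | no _ = greedy-⊇ (S ∪ ⁅ v ⁆) vs (x∈p∪q⁺ (inj₁ x∈))

  greedy-independent : ∀ S vs → Independent S → Independent (greedy S vs)
  greedy-independent S [] ind = ind
  greedy-independent S (v ∷ vs) ind with any? (λ u → u ∈? S ×-dec R? v u)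
  ... | yes _ = greedy-independent S vs ind
  ... | no fresh = greedy-independent (S ∪ ⁅ v ⁆) vs (independent-∪⁅⁆ ind fresh)

  greedy-absorbs : ∀ S vs {x} → x List.∈ vs → Absorbed (greedy S vs) x
  greedy-absorbs S (v ∷ vs) x∈ with any? (λ u → u ∈? S ×-dec R? v u)
  greedy-absorbs S (v ∷ vs) (here refl) | yes (u , u∈S , Rvu) = inj₂ (u , greedy-⊇ S vs u∈S , Rvu)
  greedy-absorbs S (v ∷ vs) (there x∈) | yes _ = greedy-absorbs S vs x∈
  greedy-absorbs S (v ∷ vs) (here refl) | no _ =
    inj₁ (greedy-⊇ (S ∪ ⁅ v ⁆) vs (x∈p∪q⁺ (inj₂ (x∈⁅x⁆ v))))
  greedy-absorbs S (v ∷ vs) (there x∈) | no _ = greedy-absorbs (S ∪ ⁅ v ⁆) vs x∈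

  maximalIndependent : Subset n
  maximalIndependent = greedy ⊥ (allFin n)

  maximalIndependent-independent : Independent maximalIndependent
  maximalIndependent-independent =
    greedy-independent ⊥ (allFin n) (λ x∈⊥ → ⊥-elim (∉⊥ x∈⊥))

  maximalIndependent-dominating : ∀ x → x ∉ maximalIndependent →
    ∃ λ y → y ∈ maximalIndependent × R x y
  maximalIndependent-dominating x x∉S with greedy-absorbs ⊥ (allFin n) (∈-allFin x)
  ... | inj₁ x∈S = ⊥-elim (x∉S x∈S)
  ... | inj₂ y = y

module BoundedPaths {n : ℕ} {E : Fin n → Fin n → Set}
  (E? : Decidable E) (E-sym : Symmetric E) where

  Path≤ : ℕ → Fin n → Fin n → Set
  Path≤ zero x y = Empty.⊥
  Path≤ (suc h) x y = E x y ⊎ ∃ λ z → E x z × Path≤ h z y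

  Path≤? : ∀ h → Decidable (Path≤ h)
  Path≤? zero x y = no λ ()
  Path≤? (suc h) x y = E? x y ⊎-dec any? (λ z → E? x z ×-dec Path≤? h z y)

  Path≤-mono : ∀ {h h' x y} → h ≤ h' → Path≤ h x y → Path≤ h' x y
  Path≤-mono (s≤s _) (inj₁ e) = inj₁ e
  Path≤-mono (s≤s h≤h') (inj₂ (z , e , p)) = inj₂ (z , e , Path≤-mono h≤h' p)

  Path≤-snoc : ∀ h {x y z} → Path≤ h x y → E y z → Path≤ (suc h) x z
  Path≤-snoc (suc h) (inj₁ e) e' = inj₂ (_ , e , inj₁ e')
  Path≤-snoc (suc h) (inj₂ (w , e , p)) e' = inj₂ (w , e , Path≤-snoc h p e')

  Path≤-sym : ∀ h → Symmetric (Path≤ h)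
  Path≤-sym (suc h) (inj₁ e) = inj₁ (E-sym e)
  Path≤-sym (suc h) (inj₂ (z , e , p)) = Path≤-snoc h (Path≤-sym h p) (E-sym e)

_++_ : ∀ {n} {R : Fin n → Fin n → Set} {x y z} → Walk R x y → Walk R y z → Walk R x z
edge a ++ W = step a W
step a V ++ W = step a (V ++ W)

mapWalk : ∀ {n} {R R' : Fin n → Fin n → Set} → (∀ {x y} → R x y → R' x y) →
  ∀ {x y} → Walk R x y → Walk R' x y
mapWalk f (edge a) = edge (f a)
mapWalk f (step a W) = step (f a) (mapWalk f W)

module WalkLength {H : Digraph} (D : HColoredDigraph H) where
  open Digraph H
  open HColoredDigraph D

  firstArc : ∀ {x y} (W : DWalk D x y) → Arc D x (second D W)
  firstArc (edge a) = a
  firstArc (step a _) = a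

  obstruction-free : ∀ u v w → T (harc (ρ u v) (ρ v w)) → obstruction D u v w ≡ 0
  obstruction-free u v w t with harc (ρ u v) (ρ v w)
  ... | true = refl
  ... | false = ⊥-elim t

  obstruction-blocked : ∀ u v w → ¬ T (harc (ρ u v) (ρ v w)) → obstruction D u v w ≡ 1
  obstruction-blocked u v w ¬t with harc (ρ u v) (ρ v w)
  ... | true = ⊥-elim (¬t _)
  ... | false = refl

  obstruction≤1 : ∀ u v w → obstruction D u v w ≤ 1
  obstruction≤1 u v w with T? (harc (ρ u v) (ρ v w))
  ... | yes t = ≤-trans (≤-reflexive (obstruction-free u v w t)) (n≤1+n 0)
  ... | no ¬t = ≤-reflexive (obstruction-blocked u v w ¬t)

  second-++ : ∀ {x y z} (V : DWalk D x y) (W : DWalk D y z) → second D (V ++ W) ≡ second D V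
  second-++ (edge _) W = refl
  second-++ (step _ _) W = refl

  hlength-++ : ∀ {x y z} (V : DWalk D x y) (W : DWalk D y z) →
    hlength D (V ++ W) ≤ hlength D V + hlength D W
  hlength-++ (edge {u} {v} _) W = +-mono-≤ (obstruction≤1 u v (second D W)) ≤-refl
  hlength-++ (step {u} {v} _ V) W
    rewrite second-++ V W
          | +-assoc (obstruction D u v (second D V)) (hlength D V) (hlength D W)
    = +-mono-≤ ≤-refl (hlength-++ V W)

  Reach : ℕ → Fin n → Fin n → Set
  Reach h x y = x ≡ y ⊎ Σ (DWalk D x y) λ W → hlength D W ≤ h

  Reach-trans : ∀ {h h' x y z} → Reach h x y → Reach h' y z → Reach (h + h') x z
  Reach-trans (inj₁ refl) (inj₁ refl) = inj₁ refl
  Reach-trans {h} (inj₁ refl) (inj₂ (W , W≤)) = inj₂ (W , ≤-trans W≤ (m≤n+m _ h))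
  Reach-trans (inj₂ (V , V≤)) (inj₁ refl) = inj₂ (V , ≤-trans V≤ (m≤m+n _ _))
  Reach-trans (inj₂ (V , V≤)) (inj₂ (W , W≤)) =
    inj₂ (V ++ W , ≤-trans (hlength-++ V W) (+-mono-≤ V≤ W≤))

  IsKLHKernel-weaken : ∀ {k l l' S} → l ≤ l' → IsKLHKernel D k l S → IsKLHKernel D k l' S
  IsKLHKernel-weaken l≤l' (far , near) = far , λ x x∉S →
    let y , y∈S , W , W≤l = near x x∉S in y , y∈S , W , ≤-trans W≤l l≤l'

module ClassLinks {H : Digraph} (D : HColoredDigraph H) {m : ℕ}
  (cls : Fin (HColoredDigraph.n D) → Fin (HColoredDigraph.n D) → Fin m) where
  open Digraph H
  open HColoredDigraph D

  ShareClass : Fin n → Fin n → Set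
  ShareClass x y = ∃ λ i → Incident D cls i x × Incident D cls i y

  ShareClass? : Decidable ShareClass
  ShareClass? x y = any? (λ i → incident? i x ×-dec incident? i y)
    where
    classArc? : ∀ i u v → Dec (ClassArc D cls i u v)
    classArc? i u v = T? (arc u v) ×-dec (cls u v ≟ i)

    incident? : ∀ i x → Dec (Incident D cls i x)
    incident? i x = any? (λ y → classArc? i x y ⊎-dec classArc? i y x)

  ShareClass-sym : Symmetric ShareClass
  ShareClass-sym (i , x∈i , y∈i) = i , y∈i , x∈i

  open BoundedPaths ShareClass? ShareClass-sym public

module HClassPartition {H : Digraph} (D : HColoredDigraph H) {m : ℕ}
  (cls : Fin (HColoredDigraph.n D) → Fin (HColoredDigraph.n D) → Fin m)
  (partition : IsHClassPartition D m cls) where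
  open Digraph H
  open HColoredDigraph D
  open WalkLength D
  open ClassLinks D cls

  firstClass : ∀ {x y} → DWalk D x y → Fin m
  firstClass {x} W = cls x (second D W)

  start∈firstClass : ∀ {x y} (W : DWalk D x y) → Incident D cls (firstClass W) x
  start∈firstClass W = _ , inj₁ (firstArc W , refl)

  walk⇒Path≤ : ∀ {x y} (W : DWalk D x y) {a} → Incident D cls (firstClass W) a →
    Path≤ (hlength D W) a y
  walk⇒Path≤ (edge {u} uy) a∈i = inj₁ (_ , a∈i , u , inj₂ (uy , refl))
  walk⇒Path≤ (step {u} {v} uv W) {a} a∈i with T? (harc (ρ u v) (ρ v (second D W)))
  ... | yes t = subst (λ h → Path≤ (h + hlength D W) a _) (sym (obstruction-free u v _ t))
      (walk⇒Path≤ W (subst (λ i → Incident D cls i a)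
        (Equivalence.to (partition u v _ uv (firstArc W)) t) a∈i))
  ... | no ¬t = subst (λ h → Path≤ (h + hlength D W) a _) (sym (obstruction-blocked u v _ ¬t))
      (inj₂ (v , (_ , a∈i , u , inj₂ (uv , refl)) , walk⇒Path≤ W (start∈firstClass W)))

  classWalk : ∀ {i x y} → Walk (ClassArc D cls i) x y → DWalk D x y
  classWalk = mapWalk proj₁

  firstClass-classWalk : ∀ {i x y} (W : Walk (ClassArc D cls i) x y) → firstClass (classWalk W) ≡ i
  firstClass-classWalk (edge (_ , e)) = e
  firstClass-classWalk (step (_ , e) _) = e

  hlength-classWalk : ∀ {i x y} (W : Walk (ClassArc D cls i) x y) → hlength D (classWalk W) ≡ 1
  hlength-classWalk (edge _) = refl
  hlength-classWalk (step {u} {v} (uv , e) W) = cong₂ _+_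
    (obstruction-free u v _ (Equivalence.from (partition u v _ uv (firstArc (classWalk W)))
      (trans e (sym (firstClass-classWalk W)))))
    (hlength-classWalk W)

  module _ (strong : ∀ i → StronglyConnected D cls i) where

    ShareClass⇒Reach : ∀ {x y} → ShareClass x y → Reach 1 x y
    ShareClass⇒Reach {x} {y} (i , x∈i , y∈i) with x ≟ y
    ... | yes x≡y = inj₁ x≡y
    ... | no x≢y = let W = strong i x y x∈i y∈i x≢y in
      inj₂ (classWalk W , ≤-reflexive (hlength-classWalk W))

    Path≤⇒Reach : ∀ h {x y} → Path≤ h x y → Reach h x y
    Path≤⇒Reach (suc h) (inj₁ e) = Reach-trans (ShareClass⇒Reach e) (inj₁ refl)
    Path≤⇒Reach (suc h) (inj₂ (_ , e , p)) = Reach-trans (ShareClass⇒Reach e) (Path≤⇒Reach h p)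

    kernelByWalks : ∀ r → ∃ λ S → IsKLHKernel D (suc r) r S
    kernelByWalks r = maximalIndependent , far , near
      where
      open MaximalIndependentSet (Path≤? r) (Path≤-sym r)

      far : ∀ x y → x ∈ maximalIndependent → y ∈ maximalIndependent → x ≢ y →
        (W : DWalk D x y) → suc r ≤ hlength D W
      far x y x∈S y∈S x≢y W with suc r ≤? hlength D W
      ... | yes r<W = r<W
      ... | no r≮W = ⊥-elim (maximalIndependent-independent x∈S y∈S x≢y
              (Path≤-mono (≤-pred (≰⇒> r≮W)) (walk⇒Path≤ W (start∈firstClass W))))

      near : ∀ x → x ∉ maximalIndependent →
        ∃ λ y → y ∈ maximalIndependent × Σ (DWalk D x y) λ W → hlength D W ≤ r
      near x x∉S with maximalIndependent-dominating x x∉S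
      ... | y , y∈S , p with Path≤⇒Reach r p
      ...   | inj₁ refl = ⊥-elim (x∉S y∈S)
      ...   | inj₂ W = y , y∈S , W

theorem8 : (H : Digraph) (D : HColoredDigraph H) (m : ℕ)
    (cls : Fin (HColoredDigraph.n D) → Fin (HColoredDigraph.n D) → Fin m) →
    IsHClassPartition D m cls →
    (∀ i → StronglyConnected D cls i) →
    ∀ k l → 2 ≤ k → suc k ≤ l →
    ∃ λ (S : Subset (HColoredDigraph.n D)) → IsKLHKernel D k l S
theorem8 H D m cls partition strong (suc r) l _ k<l =
  let S , kernel = HClassPartition.kernelByWalks D cls partition strong r
  in S , WalkLength.IsKLHKernel-weaken D (≤-trans (n≤1+n r) (<⇒≤ k<l)) kernel
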